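{- Let $G=(V,E)$ be a graph, $X,Y\subseteq V$ and $k\in\mathbb{N}$. Let $\mathcal{A}^G_{X,Y,\leq i}$ denote the set of all leftmost $(X,Y,\leq i)^G$-separators and $\mathcal{B}^G_{X,Y,\leq k}$ the set of all important $(X,Y,\leq k)^G$-separators. Then \[\mathcal{B}^G_{X,Y,\leq k}=\bigcup_{i=1}^{k}\mathcal{A}^G_{X,Y,\leq i}.\]
   Context: A set $S\subseteq V$ is an $(X,Y)^G$-separator if $G-S$ contains no path from a vertex of $X$ to a vertex of $Y$ ($X$, $Y$, $S$ may intersect). For such $S$, $V_{X,S}$ denotes the set of vertices of $G-S$ reachable in $G-S$ from $X\setminus S$, and $V_{S,Y}$ those reachable from $Y\setminus S$. A separator is minimal if no proper subset is an $(X,Y)^G$-separator. Write $S\preceq S'$ if $V_{X,S}\subseteq V_{X,S'}$. An $(X,Y,\leq k)^G$-separator is an $(X,Y)^G$-separator of size at most $k$. $S$ is a leftmost $(X,Y,\leq k)^G$-separator if it is a minimal $(X,Y,\leq k)^G$-separator and no other minimal $(X,Y,\leq k)^G$-separator $S'\neq S$ satisfies $S'\preceq S$. $S'$ dominates $S$ if $|S'|\leq|S|$ and $V_{S,Y}\subsetneq V_{S',Y}$. $S$ is an important $(X,Y,\leq k)^G$-separator if it is a minimal $(X,Y,\leq k)^G$-separator and no other minimal $(X,Y,\leq k)^G$-separator dominates $S$. -}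

module Defs where

open import Data.Nat using (ℕ; _≤_)
open import Data.Fin using (Fin)
open import Data.Fin.Subset using (Subset; _∈_; _∉_; _⊂_; ∣_∣)
open import Data.Product using (Σ; _×_; ∃-syntax)
open import Relation.Nullary using (¬_)
open import Relation.Binary.PropositionalEquality using (_≡_; _≢_)
open import Relation.Binary.Definitions using (Decidable; Symmetric)

record Graph (n : ℕ) : Set₁ where
  field
    Adj    : Fin n → Fin n → Set
    adj?   : Decidable Adj
    sym    : Symmetric Adj
    irrefl : ∀ v → ¬ Adj v v

module _ {n : ℕ} (G : Graph n) where
  open Graph G

  -- Reach S X v : v is reachable in G - S from a vertex of X ∖ S,
  -- i.e. v ∈ V_{X,S}.
  data Reach (S X : Subset n) : Fin n → Set where
    start : ∀ {v} → v ∈ X → v ∉ S → Reach S X v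
    step  : ∀ {u v} → Reach S X u → Adj u v → v ∉ S → Reach S X v

  IsSeparator : (X Y S : Subset n) → Set
  IsSeparator X Y S = ∀ y → y ∈ Y → ¬ Reach S X y

  IsMinimalSeparator : (X Y S : Subset n) → Set
  IsMinimalSeparator X Y S =
    IsSeparator X Y S × (∀ S′ → S′ ⊂ S → ¬ IsSeparator X Y S′)

  IsMinimalSeparator≤ : (X Y : Subset n) (k : ℕ) (S : Subset n) → Set
  IsMinimalSeparator≤ X Y k S = IsMinimalSeparator X Y S × ∣ S ∣ ≤ k

  Precedes : (X S S′ : Subset n) → Set
  Precedes X S S′ = ∀ v → Reach S X v → Reach S′ X v

  Dominates : (Y S′ S : Subset n) → Set
  Dominates Y S′ S =
    ∣ S′ ∣ ≤ ∣ S ∣ ×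
    (∀ v → Reach S Y v → Reach S′ Y v) ×
    (∃[ v ] (Reach S′ Y v × ¬ Reach S Y v))

  IsLeftmost : (X Y : Subset n) (k : ℕ) (S : Subset n) → Set
  IsLeftmost X Y k S =
    IsMinimalSeparator≤ X Y k S ×
    (∀ S′ → IsMinimalSeparator≤ X Y k S′ → S′ ≢ S → ¬ Precedes X S′ S)

  IsImportant : (X Y : Subset n) (k : ℕ) (S : Subset n) → Set
  IsImportant X Y k S =
    IsMinimalSeparator≤ X Y k S ×
    (∀ S′ → IsMinimalSeparator≤ X Y k S′ → S′ ≢ S → ¬ Dominates Y S′ S)

-- Every vertex of a minimal separator S lies in X or next to V_{X,S}, and
-- likewise lies in Y or next to V_{S,Y}. Consequently, for minimal
-- separators, moving the X-side inwards (S′ ≼ S) pushes the Y-side outwards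
-- (V_{S,Y} ⊆ V_{S′,Y}), and two minimal separators with S′ ≼ S whose Y-sides
-- also satisfy V_{S′,Y} ⊆ V_{S,Y} coincide. Hence a separator S′ dominating S
-- would precede it, so leftmost separators are important; conversely, a
-- separator S′ ≠ S with S′ ≼ S and |S′| ≤ |S| must have a strictly larger
-- Y-side and so would dominate S, so an important S is leftmost for i = |S|
-- (for i = 1 when S = ∅, whose Y-side is already everything outside ∅).
module Submission where

open import Defs
open import Data.Nat using (ℕ; zero; suc; _≤_; _<_; z≤n; s≤s)
open import Data.Nat.Properties using (≤-refl; ≤-trans; n≮0)
open import Data.Fin using (Fin; _≟_)
open import Data.Fin.Subset using (Subset; _∈_; _∉_; _⊆_; _-_; ∣_∣)
open import Data.Fin.Subset.Properties
  using (_∈?_; ⊆-antisym; x∈p⇒p-x⊂p; x∈p∧x≢y⇒x∈p-y; x∈p⇒∣p-x∣<∣p∣)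
open import Data.Product using (_×_; ∃-syntax; _,_; proj₁)
open import Data.Sum using (_⊎_; inj₁; inj₂)
open import Data.Empty using (⊥-elim)
open import Relation.Nullary using (¬_; yes; no)
open import Relation.Nullary.Negation using (contradiction; ¬¬-map)
open import Relation.Binary.PropositionalEquality using (_≡_; refl; sym; subst)
open import Function.Bundles using (_⇔_; mk⇔)

∣p∣≡0⇒p⊆q : ∀ {n} {p q : Subset n} → ∣ p ∣ ≡ 0 → p ⊆ q
∣p∣≡0⇒p⊆q {p = p} ∣p∣≡0 {x} x∈p =
  ⊥-elim (n≮0 (subst (∣ p - x ∣ <_) ∣p∣≡0 (x∈p⇒∣p-x∣<∣p∣ x∈p)))

module _ {n : ℕ} (G : Graph n) where
  open Graph G renaming (sym to Adj-sym)

  private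
    variable
      X Y Z S T S′ : Subset n
      v x : Fin n

  reach⇒∉ : Reach G S Z v → v ∉ S
  reach⇒∉ (start _ v∉S)  = v∉S
  reach⇒∉ (step _ _ v∉S) = v∉S

  reach-antitone : S ⊆ T → Reach G T Z v → Reach G S Z v
  reach-antitone S⊆T (start v∈Z v∉T)  = start v∈Z (λ v∈S → v∉T (S⊆T v∈S))
  reach-antitone S⊆T (step r a v∉T)   = step (reach-antitone S⊆T r) a (λ v∈S → v∉T (S⊆T v∈S))

  separator-disjoint : IsSeparator G X Y S → Reach G S Y v → ¬ Reach G S X v
  separator-disjoint sep (start v∈Y _) rX = sep _ v∈Y rX
  separator-disjoint sep (step rY a _) rX =
    separator-disjoint sep rY (step rX (Adj-sym a) (reach⇒∉ rY))

  separator-sym : IsSeparator G X Y S → IsSeparator G Y X S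
  separator-sym sep x x∈X rY = separator-disjoint sep rY (start x∈X (reach⇒∉ rY))

  minimal-sym : IsMinimalSeparator G X Y S → IsMinimalSeparator G Y X S
  minimal-sym (sep , minimal) =
    separator-sym sep , λ S′ S′⊂S sep′ → minimal S′ S′⊂S (separator-sym sep′)

  -- Removing x from S can enlarge V_{Z,S} only if x touches Z.
  Touches : (Z S : Subset n) → Fin n → Set
  Touches Z S x = x ∈ Z ⊎ ∃[ u ] (Reach G S Z u × Adj u x)

  reach-remove : ¬ Touches Z S x → Reach G (S - x) Z v → Reach G S Z v
  reach-remove {x = x} ¬t (start {v} v∈Z v∉S-x) with v ≟ x
  ... | yes refl = ⊥-elim (¬t (inj₁ v∈Z))
  ... | no v≢x   = start v∈Z (λ v∈S → v∉S-x (x∈p∧x≢y⇒x∈p-y v∈S v≢x))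
  reach-remove {x = x} ¬t (step {v = v} r a v∉S-x) with v ≟ x
  ... | yes refl = ⊥-elim (¬t (inj₂ (_ , reach-remove ¬t r , a)))
  ... | no v≢x   = step (reach-remove ¬t r) a (λ v∈S → v∉S-x (x∈p∧x≢y⇒x∈p-y v∈S v≢x))

  minimal⇒touches : IsMinimalSeparator G X Y S → x ∈ S → ¬ ¬ Touches X S x
  minimal⇒touches (sep , minimal) x∈S ¬t =
    minimal _ (x∈p⇒p-x⊂p x∈S) (λ y y∈Y r → sep y y∈Y (reach-remove ¬t r))

  touches⇒¬¬reach : Touches Z S x → (∀ v → Reach G S Z v → ¬ ¬ Reach G T Z v) →
                    x ∉ T → ¬ ¬ Reach G T Z x
  touches⇒¬¬reach (inj₁ x∈Z)          _    x∉T = contradiction (start x∈Z x∉T)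
  touches⇒¬¬reach (inj₂ (u , ru , a)) grow x∉T = ¬¬-map (λ r → step r a x∉T) (grow u ru)

  precedes⇒reach-⊇ : IsSeparator G X Y S → IsMinimalSeparator G X Y T →
                     Precedes G X T S → ∀ v → Reach G S Y v → Reach G T Y v
  precedes⇒reach-⊇ {X} {Y} {S} {T} sepS minT T≼S _ = go
    where
    avoids-T : Reach G S Y v → v ∉ T
    avoids-T rY v∈T = minimal⇒touches minT v∈T λ t →
      touches⇒¬¬reach t (λ u ru → contradiction (T≼S u ru)) (reach⇒∉ rY)
                      (separator-disjoint sepS rY)

    go : Reach G S Y v → Reach G T Y v
    go rY@(start v∈Y _) = start v∈Y (avoids-T rY)
    go rY@(step r a _)  = step (go r) a (avoids-T rY)

  precedes-unique : IsMinimalSeparator G X Y S → IsMinimalSeparator G X Y S′ →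
                    Precedes G X S′ S → (∀ v → Reach G S′ Y v → ¬ ¬ Reach G S Y v) →
                    S′ ≡ S
  precedes-unique {X} {Y} {S} {S′} minS minS′ S′≼S shrinks = ⊆-antisym S′⊆S S⊆S′
    where
    grows : ∀ v → Reach G S Y v → ¬ ¬ Reach G S′ Y v
    grows v r = contradiction (precedes⇒reach-⊇ (proj₁ minS) minS′ S′≼S v r)

    S⊆S′ : S ⊆ S′
    S⊆S′ {x} x∈S with x ∈? S′
    ... | yes x∈S′ = x∈S′
    ... | no  x∉S′ = ⊥-elim (minimal⇒touches (minimal-sym minS) x∈S λ tY →
          touches⇒¬¬reach tY grows x∉S′ λ rY′ →
          shrinks x rY′ λ rY → reach⇒∉ rY x∈S)

    S′⊆S : S′ ⊆ S
    S′⊆S {x} x∈S′ with x ∈? S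
    ... | yes x∈S = x∈S
    ... | no  x∉S = ⊥-elim (minimal⇒touches minS′ x∈S′ λ tX →
          minimal⇒touches (minimal-sym minS′) x∈S′ λ tY →
          touches⇒¬¬reach tX (λ u r → contradiction (S′≼S u r)) x∉S λ rX →
          touches⇒¬¬reach tY shrinks x∉S λ rY →
          separator-disjoint (proj₁ minS) rY rX)

  leftmost⇒important : ∀ {i k} → i ≤ k → IsLeftmost G X Y i S → IsImportant G X Y k S
  leftmost⇒important i≤k ((minS , ∣S∣≤i) , leftmost) =
    (minS , ≤-trans ∣S∣≤i i≤k) ,
    λ { S′ (minS′ , _) S′≢S (∣S′∣≤∣S∣ , reach-⊆ , _) →
        leftmost S′ (minS′ , ≤-trans ∣S′∣≤∣S∣ ∣S∣≤i) S′≢S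
          (precedes⇒reach-⊇ (separator-sym (proj₁ minS′)) (minimal-sym minS) reach-⊆) }

  important⇒leftmost : ∀ {k} → IsImportant G X Y k S → IsLeftmost G X Y ∣ S ∣ S
  important⇒leftmost ((minS , ∣S∣≤k) , important) =
    (minS , ≤-refl) ,
    λ S′ (minS′ , ∣S′∣≤∣S∣) S′≢S S′≼S → S′≢S (precedes-unique minS minS′ S′≼S
      λ v rY′ ¬rY → important S′ (minS′ , ≤-trans ∣S′∣≤∣S∣ ∣S∣≤k) S′≢S
        (∣S′∣≤∣S∣ , precedes⇒reach-⊇ (proj₁ minS) minS′ S′≼S , v , rY′ , ¬rY))

  empty-minimal⇒leftmost : IsMinimalSeparator G X Y S → ∣ S ∣ ≡ 0 →
                           ∀ i → IsLeftmost G X Y i S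
  empty-minimal⇒leftmost minS ∣S∣≡0 i =
    (minS , subst (_≤ i) (sym ∣S∣≡0) z≤n) ,
    λ S′ (minS′ , _) S′≢S S′≼S → S′≢S (precedes-unique minS minS′ S′≼S
      λ _ rY′ → contradiction (reach-antitone (∣p∣≡0⇒p⊆q ∣S∣≡0) rY′))

lemma2 : ∀ {n : ℕ} (G : Graph n) (X Y : Subset n) (k : ℕ) → 1 ≤ k →
           ∀ (S : Subset n) →
           IsImportant G X Y k S ⇔ (∃[ i ] (1 ≤ i × i ≤ k × IsLeftmost G X Y i S))
lemma2 G X Y k 1≤k S = mk⇔ to from
  where
  from : ∃[ i ] (1 ≤ i × i ≤ k × IsLeftmost G X Y i S) → IsImportant G X Y k S
  from (_ , _ , i≤k , leftmost) = leftmost⇒important G i≤k leftmost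

  to : IsImportant G X Y k S → ∃[ i ] (1 ≤ i × i ≤ k × IsLeftmost G X Y i S)
  to important@((minS , ∣S∣≤k) , _) = by-size ∣ S ∣ refl
    where
    by-size : ∀ s → ∣ S ∣ ≡ s → ∃[ i ] (1 ≤ i × i ≤ k × IsLeftmost G X Y i S)
    by-size zero    ∣S∣≡0 = 1 , ≤-refl , 1≤k , empty-minimal⇒leftmost G minS ∣S∣≡0 1
    by-size (suc m) ∣S∣≡  = suc m , s≤s z≤n , subst (_≤ k) ∣S∣≡ ∣S∣≤k ,
                            subst (λ i → IsLeftmost G X Y i S) ∣S∣≡ (important⇒leftmost G important)
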